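{- Let $G$ be a finite abelian group with identity $1$, let $S$ be an inverse-closed subset of $G\setminus\{1\}$ with $|S|\ge 3$, let $s\in S$ be such that $H=\langle S\setminus\{s,s^{ -1}\}\rangle\neq G$, and let $\Gamma=\mathrm{Cay}(G;S)$. Suppose $[G:H]=2$, $s$ has order $4$, $G\neq\langle s\rangle$, and $\Gamma$ is distance-regular with $a_1=2$. If $\Gamma$ is not $K_4$, then $c_2=2$.
   Context: $\mathrm{Cay}(G;S)$ has vertex set $G$, $g\sim h$ iff $h=gs'$ for some $s'\in S$. A connected graph is distance-regular if for each $i$ up to the diameter the numbers $c_i(x,y)=|N_{i-1}(x)\cap N(y)|$, $a_i(x,y)=|N_i(x)\cap N(y)|$, $b_i(x,y)=|N_{i+1}(x)\cap N(y)|$ depend only on the distance $i$ between $x$ and $y$ ($N_j(x)$ = vertices at distance $j$ from $x$, $N=N_1$); their values are the intersection numbers $c_i,a_i,b_i$. -}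

module Defs where

open import Level using (0ℓ)
open import Data.Nat using (ℕ; zero; suc; _<_; _≤_)
open import Data.Fin using (Fin)
open import Data.Fin.Subset using (Subset; _∈_; ∣_∣)
open import Data.Product using (Σ; ∃; _×_; _,_)
open import Relation.Binary.PropositionalEquality using (_≡_; _≢_)
open import Relation.Nullary using (¬_)
open import Algebra.Structures using (IsAbelianGroup)

record FinAbGroup (n : ℕ) : Set where
  field
    _∙_ : Fin n → Fin n → Fin n
    ε   : Fin n
    _⁻¹ : Fin n → Fin n
    isAbelianGroup : IsAbelianGroup _≡_ _∙_ ε _⁻¹
  infixl 7 _∙_
  infix 8 _⁻¹

module _ {n : ℕ} (G : FinAbGroup n) where
  open FinAbGroup G

  pow : Fin n → ℕ → Fin n
  pow g zero    = ε
  pow g (suc k) = g ∙ pow g k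

  HasOrder : Fin n → ℕ → Set
  HasOrder g k = pow g k ≡ ε × (∀ j → 1 ≤ j → j < k → pow g j ≢ ε)

  data Gen (P : Fin n → Set) : Fin n → Set where
    gen-base : ∀ {x} → P x → Gen P x
    gen-ε    : Gen P ε
    gen-∙    : ∀ {x y} → Gen P x → Gen P y → Gen P (x ∙ y)
    gen-⁻¹   : ∀ {x} → Gen P x → Gen P (x ⁻¹)

  Count : (Fin n → Set) → ℕ → Set
  Count P k = Σ (Subset n) λ A → (∀ z → (z ∈ A → P z) × (P z → z ∈ A)) × ∣ A ∣ ≡ k

  Index : (Fin n → Set) → ℕ → Set
  Index P m = Σ ℕ λ h → Count (Gen P) h × n ≡ m Data.Nat.* h

  module Cayley (S : Subset n) where
    Adj : Fin n → Fin n → Set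
    Adj g h = Σ (Fin n) λ t → t ∈ S × h ≡ g ∙ t

    data Walk : Fin n → Fin n → ℕ → Set where
      w-nil  : ∀ {x} → Walk x x zero
      w-cons : ∀ {x y z k} → Adj x y → Walk y z k → Walk x z (suc k)

    Dist : Fin n → Fin n → ℕ → Set
    Dist x y i = Walk x y i × (∀ j → j < i → ¬ Walk x y j)

    Connected : Set
    Connected = ∀ x y → ∃ λ i → Dist x y i

    -- distance-regular with intersection numbers c_i, a_i, b_i
    -- (only meaningful for i up to the diameter, since Dist x y i
    -- only holds for such i; c_i is required for i ≥ 1)
    IsDistanceRegular : (c a b : ℕ → ℕ) → Set
    IsDistanceRegular c a b =
      Connected ×
      (∀ x y i → Dist x y i →
         (∀ i' → i ≡ suc i' → Count (λ z → Dist x z i' × Adj y z) (c i)) ×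
         Count (λ z → Dist x z i × Adj y z) (a i) ×
         Count (λ z → Dist x z (suc i) × Adj y z) (b i))

    IsK4 : Set
    IsK4 = n ≡ 4 × (∀ x y → x ≢ y → Adj x y)

module Submission where

open import Defs
open import Data.Nat using (ℕ; _≤_)
open import Data.Fin using (Fin)
open import Data.Fin.Subset using (Subset; _∈_; _∉_; ∣_∣)
open import Data.Product using (∃; _×_)
open import Relation.Binary.PropositionalEquality using (_≡_; _≢_)
open import Relation.Nullary using (¬_)

open import Level using (0ℓ)
open import Data.Nat using (zero; suc; _+_; _<_; s≤s; z≤n)
open import Data.Nat.Properties using (≤-trans; ≤-reflexive; ≤-antisym; <-irrefl; +-suc; +-monoʳ-≤; n≤1+n)
open import Data.Fin using (_≟_)
open import Data.Fin.Properties using (any?)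
open import Data.Fin.Subset using (_∪_; ⁅_⁆; _⊆_; inside; outside)
open import Data.Fin.Subset.Properties
  using (_∈?_; x∈⁅x⁆; x∈⁅y⁆⇒x≡y; x∈p∪q⁺; x∈p∪q⁻; p⊆p∪q; p⊆q⇒∣p∣≤∣q∣; p⊂q⇒∣p∣<∣q∣;
         ∣⁅x⁆∣≡1; ∣⊥∣≡0; nonempty?; Empty-unique)
open import Data.Vec using ([]; _∷_)
open import Data.Product using (Σ; _,_; proj₁; proj₂)
open import Data.Sum using (_⊎_; inj₁; inj₂)
open import Data.Empty using (⊥-elim)
open import Relation.Nullary using (yes; no; _×-dec_; ¬?)
open import Relation.Binary.PropositionalEquality using (refl; sym; trans; cong; cong₂; subst; module ≡-Reasoning)
open import Algebra.Bundles using (AbelianGroup)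
import Algebra.Properties.AbelianGroup as AbelianGroupProperties

-- Proof of Lemma 7.6.  Write H = ⟨S ∖ {s, s⁻¹}⟩; since Γ is connected
-- and H ≠ G, the generator s lies outside H, so every element of S is
-- s, s⁻¹ or lies in H, and H, sH are distinct cosets.  Since G ≠ ⟨s⟩
-- some t ∈ S lies outside {s, s⁻¹, s²}, and then t ∈ H.
--   * a₁ ≥ 1 on the edge {1, s} forces s² ∈ S;
--   * if s²t ∈ S, then s, s⁻¹ and t are three common neighbours of the
--     adjacent vertices 1 and s², contradicting a₁ = 2;
--   * so s²t ∉ S, whence d(1, st) = 2 and the common neighbours of 1 and
--     st are exactly s and t, i.e. c₂ = 2.
-- The file first proves counting facts about finite subsets, then general
-- facts about Cayley graphs, then the three steps above, and finally the
-- theorem.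

-- Exactly k elements of Fin n satisfy P.  This is the definition 'Count'
-- of Defs, which does not actually depend on the group parameter.
Size : {n : ℕ} → (Fin n → Set) → ℕ → Set
Size {n} P k = Σ (Subset n) λ A → (∀ z → (z ∈ A → P z) × (P z → z ∈ A)) × ∣ A ∣ ≡ k

∣p∪q∣≤∣p∣+∣q∣ : ∀ {n} (p q : Subset n) → ∣ p ∪ q ∣ ≤ ∣ p ∣ + ∣ q ∣
∣p∪q∣≤∣p∣+∣q∣ []            []            = z≤n
∣p∪q∣≤∣p∣+∣q∣ (outside ∷ p) (outside ∷ q) = ∣p∪q∣≤∣p∣+∣q∣ p q
∣p∪q∣≤∣p∣+∣q∣ (outside ∷ p) (inside ∷ q)  =
  ≤-trans (s≤s (∣p∪q∣≤∣p∣+∣q∣ p q)) (≤-reflexive (sym (+-suc ∣ p ∣ ∣ q ∣)))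
∣p∪q∣≤∣p∣+∣q∣ (inside ∷ p)  (outside ∷ q) = s≤s (∣p∪q∣≤∣p∣+∣q∣ p q)
∣p∪q∣≤∣p∣+∣q∣ (inside ∷ p)  (inside ∷ q)  =
  s≤s (≤-trans (∣p∪q∣≤∣p∣+∣q∣ p q) (+-monoʳ-≤ ∣ p ∣ (n≤1+n ∣ q ∣)))

∣p∣<∣p∪⁅x⁆∣ : ∀ {n} (p : Subset n) {x : Fin n} → x ∉ p → ∣ p ∣ < ∣ p ∪ ⁅ x ⁆ ∣
∣p∣<∣p∪⁅x⁆∣ p {x} x∉p = p⊂q⇒∣p∣<∣q∣ (p⊆p∪q ⁅ x ⁆ , x , x∈p∪q⁺ (inj₂ (x∈⁅x⁆ x)) , x∉p)

∣⁅a⁆∪⁅b⁆∣≤2 : ∀ {n} (a b : Fin n) → ∣ ⁅ a ⁆ ∪ ⁅ b ⁆ ∣ ≤ 2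
∣⁅a⁆∪⁅b⁆∣≤2 a b = ≤-trans (∣p∪q∣≤∣p∣+∣q∣ ⁅ a ⁆ ⁅ b ⁆) (≤-reflexive (cong₂ _+_ (∣⁅x⁆∣≡1 a) (∣⁅x⁆∣≡1 b)))

2≤∣⁅a⁆∪⁅b⁆∣ : ∀ {n} {a b : Fin n} → a ≢ b → 2 ≤ ∣ ⁅ a ⁆ ∪ ⁅ b ⁆ ∣
2≤∣⁅a⁆∪⁅b⁆∣ {a = a} {b} a≢b =
  subst (λ k → suc k ≤ ∣ ⁅ a ⁆ ∪ ⁅ b ⁆ ∣) (∣⁅x⁆∣≡1 a) (∣p∣<∣p∪⁅x⁆∣ ⁅ a ⁆ (λ b∈⁅a⁆ → a≢b (sym (x∈⁅y⁆⇒x≡y a b∈⁅a⁆))))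

∈⁅a⁆∪⁅b⁆⁻ : ∀ {n} {z : Fin n} (a b : Fin n) → z ∈ ⁅ a ⁆ ∪ ⁅ b ⁆ → z ≡ a ⊎ z ≡ b
∈⁅a⁆∪⁅b⁆⁻ a b z∈ab with x∈p∪q⁻ ⁅ a ⁆ ⁅ b ⁆ z∈ab
... | inj₁ z∈⁅a⁆ = inj₁ (x∈⁅y⁆⇒x≡y a z∈⁅a⁆)
... | inj₂ z∈⁅b⁆ = inj₂ (x∈⁅y⁆⇒x≡y b z∈⁅b⁆)

module _ {n : ℕ} {P : Fin n → Set} where

  size-witness : ∀ {k} → Size P k → 1 ≤ k → ∃ P
  size-witness (A , A≡P , ∣A∣≡k) 1≤k with nonempty? A
  ... | yes (z , z∈A) = z , proj₁ (A≡P z) z∈A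
  ... | no  empty     = ⊥-elim (<-irrefl refl (subst (1 ≤_) (trans (sym ∣A∣≡k) ∣∅∣≡0) 1≤k))
    where
      ∣∅∣≡0 : ∣ A ∣ ≡ 0
      ∣∅∣≡0 = trans (cong ∣_∣ (Empty-unique empty)) (∣⊥∣≡0 n)

  size-lower : ∀ {k} (B : Subset n) → Size P k → (∀ {z} → z ∈ B → P z) → ∣ B ∣ ≤ k
  size-lower B (A , A≡P , refl) B⊆P = p⊆q⇒∣p∣≤∣q∣ λ {z} z∈B → proj₂ (A≡P z) (B⊆P z∈B)

  size-upper : ∀ {k} (B : Subset n) → Size P k → (∀ z → P z → z ∈ B) → k ≤ ∣ B ∣
  size-upper B (A , A≡P , refl) P⊆B = p⊆q⇒∣p∣≤∣q∣ λ {z} z∈A → P⊆B z (proj₁ (A≡P z) z∈A)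

  size≡2 : ∀ {k} {a b : Fin n} → Size P k → a ≢ b → P a → P b → (∀ z → P z → z ≡ a ⊎ z ≡ b) → k ≡ 2
  size≡2 {a = a} {b} size a≢b Pa Pb only-a-b = ≤-antisym
    (≤-trans (size-upper (⁅ a ⁆ ∪ ⁅ b ⁆) size ab-complete) (∣⁅a⁆∪⁅b⁆∣≤2 a b))
    (≤-trans (2≤∣⁅a⁆∪⁅b⁆∣ a≢b) (size-lower (⁅ a ⁆ ∪ ⁅ b ⁆) size ab⊆P))
    where
      ab-complete : ∀ z → P z → z ∈ ⁅ a ⁆ ∪ ⁅ b ⁆
      ab-complete z Pz with only-a-b z Pz
      ... | inj₁ refl = x∈p∪q⁺ (inj₁ (x∈⁅x⁆ z))
      ... | inj₂ refl = x∈p∪q⁺ (inj₂ (x∈⁅x⁆ z))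
      ab⊆P : ∀ {z} → z ∈ ⁅ a ⁆ ∪ ⁅ b ⁆ → P z
      ab⊆P z∈ab with ∈⁅a⁆∪⁅b⁆⁻ a b z∈ab
      ... | inj₁ refl = Pa
      ... | inj₂ refl = Pb

  size≥3 : ∀ {k} {a b c : Fin n} → Size P k → a ≢ b → a ≢ c → b ≢ c → P a → P b → P c → 3 ≤ k
  size≥3 {a = a} {b} {c} size a≢b a≢c b≢c Pa Pb Pc =
    ≤-trans (s≤s (2≤∣⁅a⁆∪⁅b⁆∣ a≢b))
      (≤-trans (∣p∣<∣p∪⁅x⁆∣ (⁅ a ⁆ ∪ ⁅ b ⁆) c∉ab) (size-lower ((⁅ a ⁆ ∪ ⁅ b ⁆) ∪ ⁅ c ⁆) size abc⊆P))
    where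
      c∉ab : c ∉ ⁅ a ⁆ ∪ ⁅ b ⁆
      c∉ab c∈ab with ∈⁅a⁆∪⁅b⁆⁻ a b c∈ab
      ... | inj₁ c≡a = a≢c (sym c≡a)
      ... | inj₂ c≡b = b≢c (sym c≡b)
      abc⊆P : ∀ {z} → z ∈ (⁅ a ⁆ ∪ ⁅ b ⁆) ∪ ⁅ c ⁆ → P z
      abc⊆P z∈abc with x∈p∪q⁻ (⁅ a ⁆ ∪ ⁅ b ⁆) ⁅ c ⁆ z∈abc
      ... | inj₂ z∈⁅c⁆ rewrite x∈⁅y⁆⇒x≡y c z∈⁅c⁆ = Pc
      ... | inj₁ z∈ab with ∈⁅a⁆∪⁅b⁆⁻ a b z∈ab
      ...   | inj₁ refl = Pa
      ...   | inj₂ refl = Pb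

module GroupLaws {n : ℕ} (G : FinAbGroup n) where
  open FinAbGroup G

  abelianGroup : AbelianGroup 0ℓ 0ℓ
  abelianGroup = record { isAbelianGroup = isAbelianGroup }

  open AbelianGroup abelianGroup public using (assoc; comm; identityˡ; identityʳ; inverseʳ)
  open AbelianGroupProperties abelianGroup public using (∙-cancelˡ; inverseˡ-unique; inverseʳ-unique; xyx⁻¹≈y)

  x∙y∙y⁻¹≡x : ∀ x y → x ∙ y ∙ y ⁻¹ ≡ x
  x∙y∙y⁻¹≡x x y = trans (assoc x y (y ⁻¹)) (trans (cong (x ∙_) (inverseʳ y)) (identityʳ x))

module CayleyLaws {n : ℕ} (G : FinAbGroup n) (S : Subset n) where
  open FinAbGroup G
  open GroupLaws G
  open Cayley G S

  walk-closed : ∀ {P} → (∀ u → u ∈ S → Gen G P u) → ∀ {x y k} → Gen G P x → Walk x y k → Gen G P y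
  walk-closed S⊆⟨P⟩ ⟨P⟩x w-nil = ⟨P⟩x
  walk-closed {P} S⊆⟨P⟩ ⟨P⟩x (w-cons (u , u∈S , y≡x∙u) w) =
    walk-closed S⊆⟨P⟩ (subst (Gen G P) (sym y≡x∙u) (gen-∙ ⟨P⟩x (S⊆⟨P⟩ u u∈S))) w

  connected-generates : Connected → ∀ {P} → (∀ u → u ∈ S → Gen G P u) → ∀ g → Gen G P g
  connected-generates connected S⊆⟨P⟩ g = walk-closed S⊆⟨P⟩ gen-ε (proj₁ (proj₂ (connected ε g)))

  walk-0 : ∀ {x y} → Walk x y 0 → x ≡ y
  walk-0 w-nil = refl

  walk-1 : ∀ {x y} → Walk x y 1 → Adj x y
  walk-1 (w-cons x~y w-nil) = x~y

  adj-ε⁻ : ∀ {z} → Adj ε z → z ∈ S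
  adj-ε⁻ (u , u∈S , z≡ε∙u) = subst (_∈ S) (sym (trans z≡ε∙u (identityˡ u))) u∈S

  dist-1⁻ : ∀ {z} → Dist ε z 1 → z ∈ S
  dist-1⁻ (w , _) = adj-ε⁻ (walk-1 w)

  module _ (ε∉S : ε ∉ S) where

    dist-1 : ∀ {z} → z ∈ S → Dist ε z 1
    dist-1 {z} z∈S = w-cons (z , z∈S , sym (identityˡ z)) w-nil , shorter
      where
        shorter : ∀ j → j < 1 → ¬ Walk ε z j
        shorter zero    _         w = ε∉S (subst (_∈ S) (sym (walk-0 w)) z∈S)
        shorter (suc j) (s≤s ())

    dist-2 : ∀ {z u v} → z ≢ ε → z ∉ S → u ∈ S → v ∈ S → z ≡ u ∙ v → Dist ε z 2
    dist-2 {z} {u} {v} z≢ε z∉S u∈S v∈S z≡u∙v =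
      w-cons (u , u∈S , sym (identityˡ u)) (w-cons (v , v∈S , z≡u∙v) w-nil) , shorter
      where
        shorter : ∀ j → j < 2 → ¬ Walk ε z j
        shorter zero          _ w = z≢ε (sym (walk-0 w))
        shorter (suc zero)    _ w = z∉S (adj-ε⁻ (walk-1 w))
        shorter (suc (suc j)) (s≤s (s≤s ()))

module Lemma7p6 {n : ℕ} (G : FinAbGroup n) (S : Subset n) (s : Fin n)
  (S⁻¹⊆S : ∀ t → t ∈ S → FinAbGroup._⁻¹ G t ∈ S) (ε∉S : FinAbGroup.ε G ∉ S) (s∈S : s ∈ S) where
  open FinAbGroup G
  open GroupLaws G
  open Cayley G S
  open CayleyLaws G S

  T : Fin n → Set
  T t = t ∈ S × t ≢ s × t ≢ s ⁻¹

  H : Fin n → Set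
  H = Gen G T

  S-trichotomy : ∀ u → u ∈ S → u ≡ s ⊎ u ≡ s ⁻¹ ⊎ H u
  S-trichotomy u u∈S with u ≟ s | u ≟ s ⁻¹
  ... | yes u≡s | _          = inj₁ u≡s
  ... | no _    | yes u≡s⁻¹  = inj₂ (inj₁ u≡s⁻¹)
  ... | no u≢s  | no u≢s⁻¹   = inj₂ (inj₂ (gen-base (u∈S , u≢s , u≢s⁻¹)))

  -- If s were in H, then S ⊆ H and connectivity would force H = G.
  s-outside-H : Connected → (∃ λ g → ¬ H g) → ¬ H s
  s-outside-H connected (g , g∉H) s∈H = g∉H (connected-generates connected S⊆H g)
    where
      S⊆H : ∀ u → u ∈ S → H u
      S⊆H u u∈S with S-trichotomy u u∈S
      ... | inj₁ refl          = s∈H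
      ... | inj₂ (inj₁ refl)   = gen-⁻¹ s∈H
      ... | inj₂ (inj₂ u∈H)    = u∈H

  -- If G ≠ ⟨s⟩, connectivity yields a generator outside {s, s⁻¹, s²};
  -- the search over the finite set S is decidable.
  generator-outside : Connected → (∃ λ g → ¬ Gen G (λ t → t ≡ s) g)
                    → ∃ λ t → t ∈ S × t ≢ s × t ≢ s ⁻¹ × t ≢ s ∙ s
  generator-outside connected (g , g∉⟨s⟩)
    with any? (λ t → t ∈? S ×-dec ¬? (t ≟ s) ×-dec ¬? (t ≟ s ⁻¹) ×-dec ¬? (t ≟ s ∙ s))
  ... | yes found = found
  ... | no none   = ⊥-elim (g∉⟨s⟩ (connected-generates connected S⊆⟨s⟩ g))
    where
      S⊆⟨s⟩ : ∀ u → u ∈ S → Gen G (λ t → t ≡ s) u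
      S⊆⟨s⟩ u u∈S with u ≟ s | u ≟ s ⁻¹ | u ≟ s ∙ s
      ... | yes refl | _        | _        = gen-base refl
      ... | no _     | yes refl | _        = gen-⁻¹ (gen-base refl)
      ... | no _     | no _     | yes refl = gen-∙ (gen-base refl) (gen-base refl)
      ... | no u≢s   | no u≢s⁻¹ | no u≢s²  = ⊥-elim (none (u , u∈S , u≢s , u≢s⁻¹ , u≢s²))

  module Order4 (s∉H : ¬ H s) (order4 : HasOrder G s 4) where
    open ≡-Reasoning

    s²∙s²≡ε : s ∙ s ∙ (s ∙ s) ≡ ε
    s²∙s²≡ε = begin
      s ∙ s ∙ (s ∙ s)         ≡⟨ assoc s s (s ∙ s) ⟩
      s ∙ (s ∙ (s ∙ s))       ≡⟨ cong (λ x → s ∙ (s ∙ (s ∙ x))) (sym (identityʳ s)) ⟩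
      s ∙ (s ∙ (s ∙ (s ∙ ε))) ≡⟨ proj₁ order4 ⟩
      ε                       ∎

    s³≡s⁻¹ : s ∙ s ∙ s ≡ s ⁻¹
    s³≡s⁻¹ = inverseʳ-unique s (s ∙ s ∙ s) (begin
      s ∙ (s ∙ s ∙ s)   ≡⟨ cong (s ∙_) (assoc s s s) ⟩
      s ∙ (s ∙ (s ∙ s)) ≡⟨ sym (assoc s s (s ∙ s)) ⟩
      s ∙ s ∙ (s ∙ s)   ≡⟨ s²∙s²≡ε ⟩
      ε                 ∎)

    s≢s⁻¹ : s ≢ s ⁻¹
    s≢s⁻¹ s≡s⁻¹ = proj₂ order4 2 (s≤s z≤n) (s≤s (s≤s (s≤s z≤n))) (begin
      s ∙ (s ∙ ε) ≡⟨ cong (s ∙_) (identityʳ s) ⟩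
      s ∙ s       ≡⟨ cong (s ∙_) s≡s⁻¹ ⟩
      s ∙ s ⁻¹    ≡⟨ inverseʳ s ⟩
      ε           ∎)

    s∙x≡s⁻¹⇒x≡s² : ∀ {x} → s ∙ x ≡ s ⁻¹ → x ≡ s ∙ s
    s∙x≡s⁻¹⇒x≡s² {x} s∙x≡s⁻¹ =
      ∙-cancelˡ s x (s ∙ s) (trans s∙x≡s⁻¹ (trans (sym s³≡s⁻¹) (assoc s s s)))

    sH∩H≡∅ : ∀ {x y} → H x → H y → s ∙ x ≢ y
    sH∩H≡∅ {x} {y} x∈H y∈H s∙x≡y = s∉H (subst H y∙x⁻¹≡s (gen-∙ y∈H (gen-⁻¹ x∈H)))
      where
        y∙x⁻¹≡s : y ∙ x ⁻¹ ≡ s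
        y∙x⁻¹≡s = trans (cong (_∙ x ⁻¹) (sym s∙x≡y)) (x∙y∙y⁻¹≡x s x)

    -- Step 1: a common neighbour of 1 and s can only be s², so s² ∈ S.
    s²∈S : ∀ {k} → Size (λ z → Dist ε z 1 × Adj s z) k → 1 ≤ k → s ∙ s ∈ S
    s²∈S size 1≤k with size-witness size 1≤k
    ... | z , 1~z , (u , u∈S , z≡s∙u) with S-trichotomy u u∈S
    ...   | inj₁ refl        = subst (_∈ S) z≡s∙u (dist-1⁻ 1~z)
    ...   | inj₂ (inj₁ refl) = ⊥-elim (ε∉S (subst (_∈ S) (trans z≡s∙u (inverseʳ s)) (dist-1⁻ 1~z)))
    ...   | inj₂ (inj₂ u∈H) with S-trichotomy z (dist-1⁻ 1~z)
    ...     | inj₁ z≡s =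
                ⊥-elim (ε∉S (subst (_∈ S) (∙-cancelˡ s u ε (trans (sym z≡s∙u) (trans z≡s (sym (identityʳ s))))) u∈S))
    ...     | inj₂ (inj₁ z≡s⁻¹) = subst (_∈ S) (s∙x≡s⁻¹⇒x≡s² (trans (sym z≡s∙u) z≡s⁻¹)) u∈S
    ...     | inj₂ (inj₂ z∈H)   = ⊥-elim (sH∩H≡∅ u∈H z∈H (sym z≡s∙u))

    -- Step 2: if s²t ∈ S for a generator t ∉ {s, s⁻¹}, then s, s⁻¹ and t
    -- are three distinct common neighbours of 1 and s².
    three-common-neighbours : ∀ {t k} → t ∈ S → t ≢ s → t ≢ s ⁻¹ → s ∙ s ∙ t ∈ S
                            → Size (λ z → Dist ε z 1 × Adj (s ∙ s) z) k → 3 ≤ k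
    three-common-neighbours {t} t∈S t≢s t≢s⁻¹ s²t∈S size =
      size≥3 size s≢s⁻¹ (λ s≡t → t≢s (sym s≡t)) (λ s⁻¹≡t → t≢s⁻¹ (sym s⁻¹≡t))
        (dist-1 ε∉S s∈S , s ⁻¹ , S⁻¹⊆S s s∈S , sym (x∙y∙y⁻¹≡x s s))
        (dist-1 ε∉S (S⁻¹⊆S s s∈S) , s , s∈S , sym s³≡s⁻¹)
        (dist-1 ε∉S t∈S , s ∙ s ∙ t , s²t∈S , sym s²∙s²t≡t)
      where
        s²∙s²t≡t : s ∙ s ∙ (s ∙ s ∙ t) ≡ t
        s²∙s²t≡t = begin
          s ∙ s ∙ (s ∙ s ∙ t) ≡⟨ sym (assoc (s ∙ s) (s ∙ s) t) ⟩
          s ∙ s ∙ (s ∙ s) ∙ t ≡⟨ cong (_∙ t) s²∙s²≡ε ⟩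
          ε ∙ t               ≡⟨ identityˡ t ⟩
          t                   ∎

    -- Step 3: if t ∈ H ∩ S, t ≠ s² and s²t ∉ S, then st lies at distance 2
    -- from 1 and its common neighbours with 1 are exactly s and t.
    module _ {t : Fin n} (t∈S : t ∈ S) (t≢s : t ≢ s) (t≢s⁻¹ : t ≢ s ⁻¹) (t≢s² : t ≢ s ∙ s)
             (s²t∉S : s ∙ s ∙ t ∉ S) where

      t∈H : H t
      t∈H = gen-base (t∈S , t≢s , t≢s⁻¹)

      st-at-distance-2 : Dist ε (s ∙ t) 2
      st-at-distance-2 = dist-2 ε∉S (sH∩H≡∅ t∈H gen-ε) st∉S s∈S t∈S refl
        where
          st∉S : s ∙ t ∉ S
          st∉S st∈S with S-trichotomy (s ∙ t) st∈S
          ... | inj₁ st≡s =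
                  ε∉S (subst (_∈ S) (∙-cancelˡ s t ε (trans st≡s (sym (identityʳ s)))) t∈S)
          ... | inj₂ (inj₁ st≡s⁻¹) = t≢s² (s∙x≡s⁻¹⇒x≡s² st≡s⁻¹)
          ... | inj₂ (inj₂ st∈H)   = sH∩H≡∅ t∈H st∈H refl

      st∙s≡s²t : s ∙ t ∙ s ≡ s ∙ s ∙ t
      st∙s≡s²t = begin
        s ∙ t ∙ s   ≡⟨ assoc s t s ⟩
        s ∙ (t ∙ s) ≡⟨ cong (s ∙_) (comm t s) ⟩
        s ∙ (s ∙ t) ≡⟨ sym (assoc s s t) ⟩
        s ∙ s ∙ t   ∎

      s²t∙u≡ε : ∀ {u} → s ∙ t ∙ u ≡ s ⁻¹ → s ∙ s ∙ t ∙ u ≡ ε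
      s²t∙u≡ε {u} stu≡s⁻¹ = begin
        s ∙ s ∙ t ∙ u     ≡⟨ cong (_∙ u) (assoc s s t) ⟩
        s ∙ (s ∙ t) ∙ u   ≡⟨ assoc s (s ∙ t) u ⟩
        s ∙ (s ∙ t ∙ u)   ≡⟨ cong (s ∙_) stu≡s⁻¹ ⟩
        s ∙ s ⁻¹          ≡⟨ inverseʳ s ⟩
        ε                 ∎

      common-neighbours-of-st : ∀ z → Dist ε z 1 × Adj (s ∙ t) z → z ≡ s ⊎ z ≡ t
      common-neighbours-of-st z (1~z , u , u∈S , z≡st∙u) with S-trichotomy u u∈S
      ... | inj₁ refl        = ⊥-elim (s²t∉S (subst (_∈ S) (trans z≡st∙u st∙s≡s²t) (dist-1⁻ 1~z)))
      ... | inj₂ (inj₁ refl) = inj₂ (trans z≡st∙u (xyx⁻¹≈y s t))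
      ... | inj₂ (inj₂ u∈H) with S-trichotomy z (dist-1⁻ 1~z)
      ...   | inj₁ z≡s          = inj₁ z≡s
      ...   | inj₂ (inj₁ z≡s⁻¹) =
                ⊥-elim (s²t∉S (subst (_∈ S) (sym (inverseˡ-unique (s ∙ s ∙ t) u (s²t∙u≡ε (trans (sym z≡st∙u) z≡s⁻¹))))
                                            (S⁻¹⊆S u u∈S)))
      ...   | inj₂ (inj₂ z∈H)   = ⊥-elim (sH∩H≡∅ (gen-∙ t∈H u∈H) z∈H (trans (sym (assoc s t u)) (sym z≡st∙u)))

      two-common-neighbours : ∀ {k} → Size (λ z → Dist ε z 1 × Adj (s ∙ t) z) k → k ≡ 2
      two-common-neighbours size =
        size≡2 size (λ s≡t → t≢s (sym s≡t))
          (dist-1 ε∉S s∈S , t ⁻¹ , S⁻¹⊆S t t∈S , sym (x∙y∙y⁻¹≡x s t))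
          (dist-1 ε∉S t∈S , s ⁻¹ , S⁻¹⊆S s s∈S , sym (xyx⁻¹≈y s t))
          common-neighbours-of-st

lemma7p6 : (n : ℕ) (G : FinAbGroup n) (S : Subset n) (s : Fin n)
           → (∀ t → t ∈ S → FinAbGroup._⁻¹ G t ∈ S)
           → FinAbGroup.ε G ∉ S
           → 3 ≤ ∣ S ∣
           → s ∈ S
           → (∃ λ g → ¬ Gen G (λ t → t ∈ S × t ≢ s × t ≢ FinAbGroup._⁻¹ G s) g)
           → Index G (λ t → t ∈ S × t ≢ s × t ≢ FinAbGroup._⁻¹ G s) 2
           → HasOrder G s 4
           → (∃ λ g → ¬ Gen G (λ t → t ≡ s) g)
           → (c a b : ℕ → ℕ)
           → Cayley.IsDistanceRegular G S c a b
           → a 1 ≡ 2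
           → ¬ Cayley.IsK4 G S
           → c 2 ≡ 2
lemma7p6 n G S s S⁻¹⊆S ε∉S _ s∈S H≠G _ order4 G≠⟨s⟩ c a b (connected , regular) a₁≡2 _ =
  conclude (generator-outside connected G≠⟨s⟩)
  where
    open FinAbGroup G
    open Cayley G S
    open CayleyLaws G S
    open Lemma7p6 G S s S⁻¹⊆S ε∉S s∈S
    open Order4 (s-outside-H connected H≠G) order4

    a₁-count : ∀ {y} → Dist ε y 1 → Size (λ z → Dist ε z 1 × Adj y z) (a 1)
    a₁-count {y} d = proj₁ (proj₂ (regular ε y 1 d))

    c₂-count : ∀ {y} → Dist ε y 2 → Size (λ z → Dist ε z 1 × Adj y z) (c 2)
    c₂-count {y} d = proj₁ (regular ε y 2 d) 1 refl

    s²-generator : s ∙ s ∈ S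
    s²-generator = s²∈S (a₁-count (dist-1 ε∉S s∈S)) (subst (1 ≤_) (sym a₁≡2) (s≤s z≤n))

    conclude : (∃ λ t → t ∈ S × t ≢ s × t ≢ s ⁻¹ × t ≢ s ∙ s) → c 2 ≡ 2
    conclude (t , t∈S , t≢s , t≢s⁻¹ , t≢s²) =
      two-common-neighbours t∈S t≢s t≢s⁻¹ t≢s² s²t∉S
        (c₂-count (st-at-distance-2 t∈S t≢s t≢s⁻¹ t≢s² s²t∉S))
      where
        s²t∉S : s ∙ s ∙ t ∉ S
        s²t∉S s²t∈S = <-irrefl refl (subst (3 ≤_) a₁≡2
          (three-common-neighbours t∈S t≢s t≢s⁻¹ s²t∈S (a₁-count (dist-1 ε∉S s²-generator))))
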